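{- Let \(\mathcal V\) be a universe, \((X,\sqsubseteq)\) a locally small \(\delta_{\mathcal V}\)-complete poset and \(x,y:X\) with \(x\sqsubseteq y\). For \(z\) with \(x\sqsubseteq z\), let \(\Delta_{x,z}:\Omega_{\mathcal V}\to X\) be \(P\mapsto\bigvee\delta_{x,z,P}\). Then \(x\) is strictly below \(y\) (i.e. \(X\) is positive, witnessed by \(x,y\)) if and only if for every \(z\) with \(y\sqsubseteq z\), the map \(\Delta_{x,z}\) is a section, i.e. has a left inverse \(r_z:X\to\Omega_{\mathcal V}\).
   Context: Setting: intensional Martin-Löf type theory with universes, function extensionality, propositional extensionality, propositional truncation. A proposition is a type with at most one element; \(\Omega_{\mathcal V}\) is the type of propositions in \(\mathcal V\). A poset is a type with a proposition-valued reflexive, transitive, antisymmetric relation \(\sqsubseteq\). For \(a\sqsubseteq b\) and a proposition \(P:\mathcal V\), \(\delta_{a,b,P}:\mathbf 1+P\to X\) sends \(\mathrm{inl}(\star)\mapsto a\), \(\mathrm{inr}(p)\mapsto b\); the poset is \(\delta_{\mathcal V}\)-complete if all such families have suprema \(\bigvee\delta_{a,b,P}\). Locally small: there is \(\sqsubseteq_{\mathcal V}:X\to X\to\mathcal V\) with \((a\sqsubseteq b)\simeq(a\sqsubseteq_{\mathcal V}b)\). \(x\) is strictly below \(y\) if \(x\sqsubseteq y\) and for every \(z\) with \(y\sqsubseteq z\) and every proposition \(P:\mathcal V\), \(z=\bigvee\delta_{x,z,P}\) implies \(P\). A map \(s\) is a section if there is \(r\) with \(r\circ s\sim\mathrm{id}\).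 -}

module Defs where

open import Level using (Level; _⊔_; suc; Setω)
open import Data.Unit.Polymorphic using (⊤; tt)
open import Data.Sum using (_⊎_; inj₁; inj₂)
open import Data.Product using (Σ; Σ-syntax; _×_; _,_; proj₁; proj₂)
open import Function.Bundles using (_↔_)
open import Relation.Binary.PropositionalEquality using (_≡_)

is-prop : ∀ {ℓ} → Set ℓ → Set ℓ
is-prop P = (p q : P) → p ≡ q

Ω : (𝓋 : Level) → Set (suc 𝓋)
Ω 𝓋 = Σ[ P ∈ Set 𝓋 ] is-prop P

FunExt : Setω
FunExt = ∀ {a b} {A : Set a} {B : A → Set b} {f g : (x : A) → B x} →
         ((x : A) → f x ≡ g x) → f ≡ g

PropExt : (𝓋 : Level) → Set (suc 𝓋)
PropExt 𝓋 = (P Q : Set 𝓋) → is-prop P → is-prop Q → (P → Q) → (Q → P) → P ≡ Q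

record Poset (𝓤 𝓣 : Level) : Set (suc (𝓤 ⊔ 𝓣)) where
  field
    Carrier  : Set 𝓤
    _⊑_      : Carrier → Carrier → Set 𝓣
    ⊑-prop   : (a b : Carrier) → is-prop (a ⊑ b)
    ⊑-refl   : (a : Carrier) → a ⊑ a
    ⊑-trans  : (a b c : Carrier) → a ⊑ b → b ⊑ c → a ⊑ c
    ⊑-antisym : (a b : Carrier) → a ⊑ b → b ⊑ a → a ≡ b

module _ {𝓤 𝓣 : Level} (𝓧 : Poset 𝓤 𝓣) where
  open Poset 𝓧

  is-sup : ∀ {𝓘} {I : Set 𝓘} → (I → Carrier) → Carrier → Set (𝓤 ⊔ 𝓣 ⊔ 𝓘)
  is-sup {I = I} α s =
    ((i : I) → α i ⊑ s) × ((u : Carrier) → ((i : I) → α i ⊑ u) → s ⊑ u)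

  δ : ∀ {𝓋} (a b : Carrier) (P : Ω 𝓋) → ⊤ {𝓋} ⊎ proj₁ P → Carrier
  δ a b P (inj₁ _) = a
  δ a b P (inj₂ _) = b

  δ-complete : (𝓋 : Level) → Set (𝓤 ⊔ 𝓣 ⊔ suc 𝓋)
  δ-complete 𝓋 = (a b : Carrier) → a ⊑ b → (P : Ω 𝓋) →
                 Σ[ s ∈ Carrier ] is-sup (δ a b P) s

  locally-small : (𝓋 : Level) → Set (𝓤 ⊔ 𝓣 ⊔ suc 𝓋)
  locally-small 𝓋 = Σ[ _⊑ᵥ_ ∈ (Carrier → Carrier → Set 𝓋) ]
                    ((a b : Carrier) → (a ⊑ b) ↔ (a ⊑ᵥ b))

  module _ {𝓋 : Level} (c : δ-complete 𝓋) where

    ⋁δ : (a b : Carrier) → a ⊑ b → Ω 𝓋 → Carrier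
    ⋁δ a b h P = proj₁ (c a b h P)

    strictly-below : Carrier → Carrier → Set (𝓤 ⊔ 𝓣 ⊔ suc 𝓋)
    strictly-below x y =
      Σ[ x⊑y ∈ x ⊑ y ] ((z : Carrier) (y⊑z : y ⊑ z) (P : Ω 𝓋) →
         z ≡ ⋁δ x z (⊑-trans x y z x⊑y y⊑z) P → proj₁ P)

    Δ : (x z : Carrier) → x ⊑ z → Ω 𝓋 → Carrier
    Δ x z h P = ⋁δ x z h P

    is-section : ∀ {a b} {A : Set a} {B : Set b} → (A → B) → Set (a ⊔ b)
    is-section {A = A} {B} s = Σ[ r ∈ (B → A) ] ((p : A) → r (s p) ≡ p)

-- Δ_{x,z}(P) lies below z and reaches z exactly when P holds; in particular Δ_{x,z}(⊤) = z.
-- Hence a retraction of Δ_{x,z} turns z = Δ_{x,z}(P) into ⊤ = P. Conversely, if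
-- z = Δ_{x,z}(P) forces P, then w ↦ (z ⊑ᵥ w) is a retraction: z ⊑ᵥ Δ_{x,z}(P) is
-- logically equivalent to P, and propositional extensionality makes them equal.
-- Local smallness is what makes z ⊑ᵥ w a proposition in 𝓥.
module Submission where

open import Defs
open import Level using (Level; _⊔_; suc)
open import Data.Product using (Σ; _,_; proj₁; proj₂)
open import Data.Sum using (inj₁; inj₂)
open import Data.Unit.Polymorphic using (⊤; tt)
open import Function.Bundles using (_⇔_; _↔_; Inverse; mk⇔)
open import Axiom.UniquenessOfIdentityProofs using (UIP; module Constant⇒UIP)
open import Relation.Binary.PropositionalEquality

is-prop⇒UIP : ∀ {ℓ} {A : Set ℓ} → is-prop A → UIP A
is-prop⇒UIP h = Constant⇒UIP.≡-irrelevant (λ {a} {b} _ → h a b) (λ _ _ → refl)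

is-prop-is-prop : FunExt → ∀ {ℓ} {A : Set ℓ} → is-prop (is-prop A)
is-prop-is-prop fe h k = fe λ p → fe λ q → is-prop⇒UIP h (h p q) (k p q)

↔-is-prop : ∀ {a b} {A : Set a} {B : Set b} → A ↔ B → is-prop A → is-prop B
↔-is-prop A↔B h p q = begin
  p             ≡⟨ sym (strictlyInverseˡ p) ⟩
  to (from p)   ≡⟨ cong to (h (from p) (from q)) ⟩
  to (from q)   ≡⟨ strictlyInverseˡ q ⟩
  q             ∎
  where
  open Inverse A↔B
  open ≡-Reasoning

Ω-ext : FunExt → ∀ {𝓋} → PropExt 𝓋 → {P Q : Ω 𝓋} →
        (proj₁ P → proj₁ Q) → (proj₁ Q → proj₁ P) → P ≡ Q
Ω-ext fe pe {P , h} {Q , k} P→Q Q→P with pe P Q h k P→Q Q→P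
... | refl = cong (P ,_) (is-prop-is-prop fe h k)

⊤Ω : ∀ {𝓋} → Ω 𝓋
⊤Ω = ⊤ , λ _ _ → refl

section-injective : ∀ {a b} {A : Set a} {B : Set b} {s : A → B} →
                    (Σ (B → A) λ r → (p : A) → r (s p) ≡ p) →
                    ∀ {p q} → s p ≡ s q → p ≡ q
section-injective (r , rs) {p} {q} e = trans (sym (rs p)) (trans (cong r e) (rs q))

module _ {𝓤 𝓣 𝓋 : Level} (𝓧 : Poset 𝓤 𝓣) (c : δ-complete 𝓧 𝓋) where
  open Poset 𝓧

  module _ {a b : Carrier} (a⊑b : a ⊑ b) (P : Ω 𝓋) where

    ⋁δ-upper : proj₁ P → b ⊑ ⋁δ 𝓧 c a b a⊑b P
    ⋁δ-upper p = proj₁ (proj₂ (c a b a⊑b P)) (inj₂ p)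

    ⋁δ-least : ⋁δ 𝓧 c a b a⊑b P ⊑ b
    ⋁δ-least = proj₂ (proj₂ (c a b a⊑b P)) b λ { (inj₁ _) → a⊑b ; (inj₂ _) → ⊑-refl b }

  ⋁δ-⊤ : {a b : Carrier} (a⊑b : a ⊑ b) → ⋁δ 𝓧 c a b a⊑b ⊤Ω ≡ b
  ⋁δ-⊤ a⊑b = ⊑-antisym _ _ (⋁δ-least a⊑b ⊤Ω) (⋁δ-upper a⊑b ⊤Ω tt)

  top⊑⋁δ⇒top≡⋁δ : {a b : Carrier} (a⊑b : a ⊑ b) (P : Ω 𝓋) →
                  b ⊑ ⋁δ 𝓧 c a b a⊑b P → b ≡ ⋁δ 𝓧 c a b a⊑b P
  top⊑⋁δ⇒top≡⋁δ a⊑b P b⊑s = ⊑-antisym _ _ b⊑s (⋁δ-least a⊑b P)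

  ⋁δ-detects : {a b : Carrier} → a ⊑ b → Set (𝓤 ⊔ suc 𝓋)
  ⋁δ-detects {a} {b} a⊑b = (P : Ω 𝓋) → b ≡ ⋁δ 𝓧 c a b a⊑b P → proj₁ P

  Δ-section⇒⋁δ-detects : {a b : Carrier} (a⊑b : a ⊑ b) →
                         is-section 𝓧 c (Δ 𝓧 c a b a⊑b) → ⋁δ-detects a⊑b
  Δ-section⇒⋁δ-detects a⊑b sec P b≡⋁δ =
    subst proj₁ (section-injective sec (trans (⋁δ-⊤ a⊑b) b≡⋁δ)) tt

  ⋁δ-detects⇒Δ-section : FunExt → PropExt 𝓋 → locally-small 𝓧 𝓋 →
                         {a b : Carrier} (a⊑b : a ⊑ b) →
                         ⋁δ-detects a⊑b → is-section 𝓧 c (Δ 𝓧 c a b a⊑b)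
  ⋁δ-detects⇒Δ-section fe pe (_⊑ᵥ_ , ⊑↔⊑ᵥ) {a} {b} a⊑b detects = r , r∘Δ≡id
    where
    open module ⊑ᵥ-equiv {u} {w} = Inverse (⊑↔⊑ᵥ u w) using (to; from)

    r : Carrier → Ω 𝓋
    r w = (b ⊑ᵥ w) , ↔-is-prop (⊑↔⊑ᵥ b w) (⊑-prop b w)

    r∘Δ≡id : (P : Ω 𝓋) → r (Δ 𝓧 c a b a⊑b P) ≡ P
    r∘Δ≡id P = Ω-ext fe pe (λ b⊑ᵥs → detects P (top⊑⋁δ⇒top≡⋁δ a⊑b P (from b⊑ᵥs)))
                           (λ p → to (⋁δ-upper a⊑b P p))

lemma3p21 : FunExt → {𝓋 : Level} → PropExt 𝓋 →
    {𝓤 𝓣 : Level} (𝓧 : Poset 𝓤 𝓣) →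
    locally-small 𝓧 𝓋 → (c : δ-complete 𝓧 𝓋) →
    (x y : Poset.Carrier 𝓧) (x⊑y : Poset._⊑_ 𝓧 x y) →
    strictly-below 𝓧 c x y
      ⇔ ((z : Poset.Carrier 𝓧) (y⊑z : Poset._⊑_ 𝓧 y z) →
         is-section 𝓧 c (Δ 𝓧 c x z (Poset.⊑-trans 𝓧 x y z x⊑y y⊑z)))
lemma3p21 fe {𝓋} pe {𝓤} {𝓣} 𝓧 ls c x y x⊑y = mk⇔ strictly-below⇒sections sections⇒strictly-below
  where
  open Poset 𝓧

  Sections : Set (𝓤 ⊔ 𝓣 ⊔ suc 𝓋)
  Sections = (z : Carrier) (y⊑z : y ⊑ z) → is-section 𝓧 c (Δ 𝓧 c x z (⊑-trans x y z x⊑y y⊑z))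

  strictly-below⇒sections : strictly-below 𝓧 c x y → Sections
  strictly-below⇒sections (x⊑y' , detects) z y⊑z
    -- strictly-below carries its own proof of x ⊑ y; ⊑ is proposition-valued
    with refl ← ⊑-prop x y x⊑y' x⊑y
    = ⋁δ-detects⇒Δ-section 𝓧 c fe pe ls _ (detects z y⊑z)

  sections⇒strictly-below : Sections → strictly-below 𝓧 c x y
  sections⇒strictly-below sections =
    x⊑y , λ z y⊑z → Δ-section⇒⋁δ-detects 𝓧 c _ (sections z y⊑z)
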